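{- Every co-Heyting algebra that is existentially closed in the class of all co-Heyting algebras satisfies the density axiom D1 and the splitting axiom S1.
   Context: A co-Heyting algebra is a bounded distributive lattice $(L,\mathbf{0},\mathbf{1},\vee,\wedge)$ with a binary operation $-$ such that $a-b$ is the least $c\in L$ with $a\le b\vee c$; it is regarded as a first-order structure in the language $\{\mathbf 0,\mathbf 1,\vee,\wedge,-\}$, and embeddings, subalgebras and extensions are taken in this language. For $a,b\in L$ write $b\ll a$ iff $a-b=a$ and $b\le a$. An algebra $L$ in a class $\mathcal V$ is existentially closed in $\mathcal V$ if every existential formula with parameters in $L$ that holds in some extension of $L$ belonging to $\mathcal V$ already holds in $L$. Axiom D1: for all $a,c$ with $c\ll a$ and $a\neq\mathbf 0$ there is $b\neq\mathbf 0$ with $c\ll b\ll a$. Axiom S1: for all $a,b_1,b_2$ with $b_1\vee b_2\ll a$ and $a\ne\mathbf 0$ there are non-zero $a_1,a_2$ with $a-a_2=a_1\ge b_1$, $a-a_1=a_2\ge b_2$, and $a_1\wedge a_2=b_1\wedge b_2$. -}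

module Defs where

open import Level using (Level; _⊔_; Setω) renaming (suc to lsuc)
open import Data.Nat using (ℕ; zero; suc)
open import Data.Fin using (Fin)
open import Data.Product using (Σ; _×_; _,_; ∃)
open import Data.Sum using (_⊎_)
open import Relation.Binary.PropositionalEquality using (_≡_; _≢_)
open import Relation.Nullary using (¬_)
open import Function.Definitions using (Injective)

record CoHeyting (ℓ : Level) : Set (lsuc ℓ) where
  infixr 6 _∨_
  infixr 7 _∧_
  infixl 8 _-_
  infix 4 _≤_
  field
    Carrier : Set ℓ
    𝟘 𝟙     : Carrier
    _∨_ _∧_ _-_ : Carrier → Carrier → Carrier

  _≤_ : Carrier → Carrier → Set ℓ
  a ≤ b = a ∧ b ≡ a

  field
    ∨-assoc  : ∀ a b c → (a ∨ b) ∨ c ≡ a ∨ (b ∨ c)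
    ∧-assoc  : ∀ a b c → (a ∧ b) ∧ c ≡ a ∧ (b ∧ c)
    ∨-comm   : ∀ a b → a ∨ b ≡ b ∨ a
    ∧-comm   : ∀ a b → a ∧ b ≡ b ∧ a
    ∨-absorb : ∀ a b → a ∨ (a ∧ b) ≡ a
    ∧-absorb : ∀ a b → a ∧ (a ∨ b) ≡ a
    ∧-distrib-∨ : ∀ a b c → a ∧ (b ∨ c) ≡ (a ∧ b) ∨ (a ∧ c)
    𝟘-least  : ∀ a → 𝟘 ≤ a
    𝟙-great  : ∀ a → a ≤ 𝟙
    -‿covers : ∀ a b → a ≤ b ∨ (a - b)
    -‿least  : ∀ a b c → a ≤ b ∨ c → a - b ≤ c

  _≪_ : Carrier → Carrier → Set ℓ
  b ≪ a = (a - b ≡ a) × (b ≤ a)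

record Embedding {ℓ ℓ'} (L : CoHeyting ℓ) (M : CoHeyting ℓ') : Set (ℓ ⊔ ℓ') where
  private
    module L = CoHeyting L
    module M = CoHeyting M
  field
    f       : L.Carrier → M.Carrier
    f-inj   : Injective _≡_ _≡_ f
    f-𝟘     : f L.𝟘 ≡ M.𝟘
    f-𝟙     : f L.𝟙 ≡ M.𝟙
    f-∨     : ∀ a b → f (a L.∨ b) ≡ f a M.∨ f b
    f-∧     : ∀ a b → f (a L.∧ b) ≡ f a M.∧ f b
    f-−     : ∀ a b → f (a L.- b) ≡ f a M.- f b

data Term {p} (P : Set p) (n : ℕ) : Set p where
  var  : Fin n → Term P n
  par  : P → Term P n
  `𝟘 `𝟙 : Term P n
  _`∨_ _`∧_ _`-_ : Term P n → Term P n → Term P n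

data QF {p} (P : Set p) (n : ℕ) : Set p where
  _`≡_  : Term P n → Term P n → QF P n
  `¬    : QF P n → QF P n
  _`×_ _`⊎_ : QF P n → QF P n → QF P n

record ExFormula {p} (P : Set p) : Set p where
  constructor ∃[_]_
  field
    arity : ℕ
    body  : QF P arity

module _ {ℓ} (M : CoHeyting ℓ) where
  open CoHeyting M

  ⟦_⟧t : ∀ {p} {P : Set p} {n} → Term P n → (P → Carrier) → (Fin n → Carrier) → Carrier
  ⟦ var i ⟧t π ρ = ρ i
  ⟦ par x ⟧t π ρ = π x
  ⟦ `𝟘 ⟧t π ρ = 𝟘
  ⟦ `𝟙 ⟧t π ρ = 𝟙
  ⟦ s `∨ t ⟧t π ρ = ⟦ s ⟧t π ρ ∨ ⟦ t ⟧t π ρ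
  ⟦ s `∧ t ⟧t π ρ = ⟦ s ⟧t π ρ ∧ ⟦ t ⟧t π ρ
  ⟦ s `- t ⟧t π ρ = ⟦ s ⟧t π ρ - ⟦ t ⟧t π ρ

  ⟦_⟧q : ∀ {p} {P : Set p} {n} → QF P n → (P → Carrier) → (Fin n → Carrier) → Set ℓ
  ⟦ s `≡ t ⟧q π ρ = ⟦ s ⟧t π ρ ≡ ⟦ t ⟧t π ρ
  ⟦ `¬ φ ⟧q π ρ = ¬ ⟦ φ ⟧q π ρ
  ⟦ φ `× ψ ⟧q π ρ = ⟦ φ ⟧q π ρ × ⟦ ψ ⟧q π ρ
  ⟦ φ `⊎ ψ ⟧q π ρ = ⟦ φ ⟧q π ρ ⊎ ⟦ ψ ⟧q π ρ

  Sat : ∀ {p} {P : Set p} → ExFormula P → (P → Carrier) → Set ℓ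
  Sat (∃[ n ] φ) π = Σ (Fin n → Carrier) λ ρ → ⟦ φ ⟧q π ρ

IsExistentiallyClosed : ∀ {ℓ} → CoHeyting ℓ → Setω
IsExistentiallyClosed {ℓ} L =
  ∀ {ℓ'} (M : CoHeyting ℓ') (e : Embedding L M) (φ : ExFormula (CoHeyting.Carrier L)) →
  Sat M φ (Embedding.f e) → Sat L φ (λ x → x)

D1 : ∀ {ℓ} → CoHeyting ℓ → Set ℓ
D1 L = ∀ a c → c ≪ a → a ≢ 𝟘 → Σ Carrier λ b → (b ≢ 𝟘) × (c ≪ b) × (b ≪ a)
  where open CoHeyting L

S1 : ∀ {ℓ} → CoHeyting ℓ → Set ℓ
S1 L = ∀ a b₁ b₂ → (b₁ ∨ b₂) ≪ a → a ≢ 𝟘 →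
  Σ Carrier λ a₁ → Σ Carrier λ a₂ →
    (a₁ ≢ 𝟘) × (a₂ ≢ 𝟘) ×
    (a - a₂ ≡ a₁) × (b₁ ≤ a₁) ×
    (a - a₁ ≡ a₂) × (b₂ ≤ a₂) ×
    (a₁ ∧ a₂ ≡ b₁ ∧ b₂)
  where open CoHeyting L

module Submission where

open import Defs
open import Level using (_⊔_)
open import Data.Nat using (ℕ)
open import Data.Fin using (zero; suc)
open import Data.Product using (Σ; _×_; _,_; proj₁; proj₂; zip′)
open import Function using (_∘_)
open import Relation.Nullary using (¬_)
open import Relation.Binary.PropositionalEquality
  using (_≡_; _≢_; refl; sym; trans; cong; cong₂; subst; isEquivalence; module ≡-Reasoning)
open import Axiom.UniquenessOfIdentityProofs.WithK using (uip)
open import Relation.Binary.Lattice using (DistributiveLattice)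
import Relation.Binary.Lattice.Properties.JoinSemilattice as JoinSemilatticeProperties
import Relation.Binary.Lattice.Properties.MeetSemilattice as MeetSemilatticeProperties
import Relation.Binary.Lattice.Properties.DistributiveLattice as DistributiveLatticeProperties
import Relation.Binary.Reasoning.PartialOrder as PosetReasoning

-- An existentially closed L satisfies every existential sentence over L that holds in some
-- extension, so for each instance of D1 and S1 it suffices to embed L into a co-Heyting algebra
-- containing the required witnesses. Both extensions are the fixed points, below a closed top t,
-- of a join-preserving closure operator κ on L² resp. L³; such fixed points always form a
-- co-Heyting algebra, with difference κ (x - y).
--   D1, given c ≪ a: L embeds as the pairs (x , x ∨ c), and b = (c , a) satisfies c ≪ b ≪ a.
--   S1, given b₁ ∨ b₂ ≪ a and β = b₁ ∧ b₂: L embeds as the triples (x ∧ β , x ∨ b₁ , x ∨ b₂),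
--   and a is split by a₁ = (β , b₁ , a) and a₂ = (β , a , b₂).

module CoHeytingProperties {ℓ} (L : CoHeyting ℓ) where
  open CoHeyting L

  private
    ∧-idem : ∀ a → a ∧ a ≡ a
    ∧-idem a = trans (cong (a ∧_) (sym (∨-absorb a a))) (∧-absorb a (a ∧ a))

    ≤⇒∨≡ : ∀ {a b} → a ≤ b → a ∨ b ≡ b
    ≤⇒∨≡ {a} {b} a≤b = begin
      a ∨ b       ≡⟨ cong (_∨ b) (sym a≤b) ⟩
      a ∧ b ∨ b   ≡⟨ ∨-comm (a ∧ b) b ⟩
      b ∨ a ∧ b   ≡⟨ cong (b ∨_) (∧-comm a b) ⟩
      b ∨ b ∧ a   ≡⟨ ∨-absorb b a ⟩
      b           ∎
      where open ≡-Reasoning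

    ∨≡⇒≤ : ∀ {a b} → a ∨ b ≡ b → a ≤ b
    ∨≡⇒≤ {a} {b} eq = trans (cong (a ∧_) (sym eq)) (∧-absorb a b)

  distributiveLattice : DistributiveLattice ℓ ℓ ℓ
  distributiveLattice = record
    { Carrier = Carrier ; _≈_ = _≡_ ; _≤_ = _≤_ ; _∨_ = _∨_ ; _∧_ = _∧_
    ; isDistributiveLattice = record
      { isLattice = record
        { isPartialOrder = record
          { isPreorder = record
            { isEquivalence = isEquivalence
            ; reflexive     = λ { refl → ∧-idem _ }
            ; trans         = λ {a} {b} {c} a≤b b≤c →
                trans (cong (_∧ c) (sym a≤b)) (trans (∧-assoc a b c) (trans (cong (a ∧_) b≤c) a≤b))
            }
          ; antisym = λ {a} {b} a≤b b≤a → trans (sym a≤b) (trans (∧-comm a b) b≤a)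
          }
        ; supremum = λ a b →
            ∧-absorb a b ,
            subst (b ≤_) (∨-comm b a) (∧-absorb b a) ,
            λ c a≤c b≤c → ∨≡⇒≤ (trans (∨-assoc a b c) (trans (cong (a ∨_) (≤⇒∨≡ b≤c)) (≤⇒∨≡ a≤c)))
        ; infimum = λ a b →
            trans (∧-assoc a b a) (trans (cong (a ∧_) (∧-comm b a))
              (trans (sym (∧-assoc a a b)) (cong (_∧ b) (∧-idem a)))) ,
            trans (∧-assoc a b b) (cong (a ∧_) (∧-idem b)) ,
            λ c c≤a c≤b → trans (sym (∧-assoc c a b)) (trans (cong (_∧ b) c≤a) c≤b)
        }
      ; ∧-distribˡ-∨ = ∧-distrib-∨
      }
    }

  open DistributiveLattice distributiveLattice public
    using (poset; x≤x∨y; y≤x∨y; ∨-least; x∧y≤x; x∧y≤y; ∧-greatest)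
    renaming (refl to ≤-refl; reflexive to ≤-reflexive; trans to ≤-trans; antisym to ≤-antisym)
  open JoinSemilatticeProperties (DistributiveLattice.joinSemilattice distributiveLattice) public
    using (∨-monotonic; x≤y⇒x∨y≈y)
  open MeetSemilatticeProperties (DistributiveLattice.meetSemilattice distributiveLattice) public
    using (∧-monotonic; y≤x⇒x∧y≈y)
  open DistributiveLatticeProperties distributiveLattice public
    using (∧-distribʳ-∨; ∨-distribˡ-∧; ∨-distribʳ-∧)

  infixr 4 _⨾_
  _⨾_ : ∀ {x y z} → x ≤ y → y ≤ z → x ≤ z
  _⨾_ = ≤-trans

  ∨-interchange : ∀ a b c d → (a ∨ b) ∨ (c ∨ d) ≤ (a ∨ c) ∨ (b ∨ d)
  ∨-interchange a b c d =
    ∨-least (∨-monotonic (x≤x∨y a c) (x≤x∨y b d)) (∨-monotonic (y≤x∨y a c) (y≤x∨y b d))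

  ∨-distribʳ-∨ : ∀ x y z → (x ∨ y) ∨ z ≡ (x ∨ z) ∨ (y ∨ z)
  ∨-distribʳ-∨ x y z = ≤-antisym
    (∨-least (∨-monotonic (x≤x∨y x z) (x≤x∨y y z)) (y≤x∨y y z ⨾ y≤x∨y (x ∨ z) (y ∨ z)))
    (∨-least (∨-monotonic (x≤x∨y x y) ≤-refl) (∨-monotonic (y≤x∨y x y) ≤-refl))

  ∧-distribʳ-∧ : ∀ x y z → (x ∧ y) ∧ z ≡ (x ∧ z) ∧ (y ∧ z)
  ∧-distribʳ-∧ x y z = ≤-antisym
    (∧-greatest (∧-monotonic (x∧y≤x x y) ≤-refl) (∧-monotonic (x∧y≤y x y) ≤-refl))
    (∧-greatest (∧-monotonic (x∧y≤x x z) (x∧y≤x y z)) (x∧y≤y (x ∧ z) (y ∧ z) ⨾ x∧y≤y y z))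

  ∧-∨-cancelʳ : ∀ {x y z} → x ∧ z ≡ y ∧ z → x ∨ z ≡ y ∨ z → x ≡ y
  ∧-∨-cancelʳ ∧≡ ∨≡ = ≤-antisym (≤-cancel ∧≡ ∨≡) (≤-cancel (sym ∧≡) (sym ∨≡))
    where
    ≤-cancel : ∀ {x y z} → x ∧ z ≡ y ∧ z → x ∨ z ≡ y ∨ z → x ≤ y
    ≤-cancel {x} {y} {z} ∧≡ ∨≡ = begin
      x              ≤⟨ ∧-greatest ≤-refl (x≤x∨y x z) ⟩
      x ∧ (x ∨ z)    ≡⟨ cong (x ∧_) ∨≡ ⟩
      x ∧ (y ∨ z)    ≡⟨ ∧-distrib-∨ x y z ⟩
      x ∧ y ∨ x ∧ z  ≡⟨ cong (x ∧ y ∨_) ∧≡ ⟩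
      x ∧ y ∨ y ∧ z  ≤⟨ ∨-least (x∧y≤y x y) (x∧y≤x y z) ⟩
      y              ∎
      where open PosetReasoning poset

  [x∨y]∧[z∨w]≤x∧z∨[y∨w] : ∀ x y z w → (x ∨ y) ∧ (z ∨ w) ≤ x ∧ z ∨ (y ∨ w)
  [x∨y]∧[z∨w]≤x∧z∨[y∨w] x y z w =
    ≤-reflexive (∧-distribʳ-∨ (z ∨ w) x y)
    ⨾ ∨-least (≤-reflexive (∧-distrib-∨ x z w) ⨾ ∨-monotonic ≤-refl (x∧y≤y x w ⨾ y≤x∨y y w))
              (x∧y≤x y (z ∨ w) ⨾ x≤x∨y y w ⨾ y≤x∨y (x ∧ z) (y ∨ w))

  x-y≤x : ∀ x y → x - y ≤ x
  x-y≤x x y = -‿least x y x (y≤x∨y y x)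

  -‿monoˡ-≤ : ∀ {x x'} y → x ≤ x' → x - y ≤ x' - y
  -‿monoˡ-≤ {x} {x'} y x≤x' = -‿least x y (x' - y) (x≤x' ⨾ -‿covers x' y)

  -‿antitoneʳ : ∀ x {y y'} → y ≤ y' → x - y' ≤ x - y
  -‿antitoneʳ x {y} {y'} y≤y' = -‿least x y' (x - y) (-‿covers x y ⨾ ∨-monotonic y≤y' ≤-refl)

  x≤y⇒x-y≤𝟘 : ∀ {x y} → x ≤ y → x - y ≤ 𝟘
  x≤y⇒x-y≤𝟘 {x} {y} x≤y = -‿least x y 𝟘 (x≤y ⨾ x≤x∨y y 𝟘)

  [x∨y]-z≤[x-z]∨[y-z] : ∀ x y z → (x ∨ y) - z ≤ (x - z) ∨ (y - z)
  [x∨y]-z≤[x-z]∨[y-z] x y z = -‿least (x ∨ y) z ((x - z) ∨ (y - z))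
    (∨-least (-‿covers x z ⨾ ∨-monotonic ≤-refl (x≤x∨y (x - z) (y - z)))
             (-‿covers y z ⨾ ∨-monotonic ≤-refl (y≤x∨y (x - z) (y - z))))

  -‿∧-subadditive : ∀ z w x y → ((x ∨ y) - z) ∧ w ≤ (x - z) ∧ w ∨ (y - z) ∧ w
  -‿∧-subadditive z w x y =
    ∧-monotonic ([x∨y]-z≤[x-z]∨[y-z] x y z) ≤-refl ⨾ ≤-reflexive (∧-distribʳ-∨ w (x - z) (y - z))

  [x∨y]-y≤x-y : ∀ x y → (x ∨ y) - y ≤ x - y
  [x∨y]-y≤x-y x y = -‿least (x ∨ y) y (x - y) (∨-least (-‿covers x y) (x≤x∨y y (x - y)))

  [x∨y]-y≤x : ∀ x y → (x ∨ y) - y ≤ x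
  [x∨y]-y≤x x y = [x∨y]-y≤x-y x y ⨾ x-y≤x x y

  [x∨z]-[y∨z]≤x-y : ∀ x y z → (x ∨ z) - (y ∨ z) ≤ x - y
  [x∨z]-[y∨z]≤x-y x y z = -‿least (x ∨ z) (y ∨ z) (x - y)
    (∨-least (-‿covers x y ⨾ ∨-monotonic (x≤x∨y y z) ≤-refl) (y≤x∨y y z ⨾ x≤x∨y (y ∨ z) (x - y)))

  x-y≤z∨[[x∨z]-[y∨z]-z] : ∀ x y z → x - y ≤ z ∨ (((x ∨ z) - (y ∨ z)) - z)
  x-y≤z∨[[x∨z]-[y∨z]-z] x y z = -‿least x y (z ∨ (d - z))
    (x≤x∨y x z ⨾ -‿covers (x ∨ z) (y ∨ z) ⨾ ≤-reflexive (∨-assoc y z d)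
     ⨾ ∨-monotonic ≤-refl (∨-least (x≤x∨y z (d - z)) (-‿covers d z)))
    where d = (x ∨ z) - (y ∨ z)

  [x∧z]-[y∧z]≤[x-y]∧z : ∀ x y z → (x ∧ z) - (y ∧ z) ≤ (x - y) ∧ z
  [x∧z]-[y∧z]≤[x-y]∧z x y z = ∧-greatest
    (-‿least (x ∧ z) (y ∧ z) (x - y)
      (∧-monotonic (-‿covers x y) ≤-refl ⨾ ≤-reflexive (∧-distribʳ-∨ z y (x - y))
       ⨾ ∨-monotonic ≤-refl (x∧y≤x (x - y) z)))
    (x-y≤x (x ∧ z) (y ∧ z) ⨾ x∧y≤y x z)

  [x-y]∧z≤[x∧z]-[y∧z]∨q∧z : ∀ {x y z q} → x - y ≤ z ∨ q →
                            (x - y) ∧ z ≤ ((x ∧ z) - (y ∧ z)) ∨ q ∧ z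
  [x-y]∧z≤[x∧z]-[y∧z]∨q∧z {x} {y} {z} {q} x-y≤z∨q = begin
    (x - y) ∧ z    ≤⟨ ∧-monotonic (-‿least x y (d ∨ q) x≤y∨d∨q) ≤-refl ⟩
    (d ∨ q) ∧ z    ≡⟨ ∧-distribʳ-∨ z d q ⟩
    d ∧ z ∨ q ∧ z  ≤⟨ ∨-monotonic (x∧y≤x d z) ≤-refl ⟩
    d ∨ q ∧ z      ∎
    where
    open PosetReasoning poset
    d = (x ∧ z) - (y ∧ z)
    x≤y∨d∨q : x ≤ y ∨ (d ∨ q)
    x≤y∨d∨q = begin
      x                      ≤⟨ ∧-greatest ≤-refl (-‿covers x y ⨾ ∨-monotonic ≤-refl x-y≤z∨q) ⟩
      x ∧ (y ∨ z ∨ q)        ≡⟨ ∧-distrib-∨ x y (z ∨ q) ⟩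
      x ∧ y ∨ x ∧ (z ∨ q)    ≡⟨ cong (x ∧ y ∨_) (∧-distrib-∨ x z q) ⟩
      x ∧ y ∨ x ∧ z ∨ x ∧ q  ≤⟨ ∨-monotonic (x∧y≤y x y)
                                  (∨-monotonic (-‿covers (x ∧ z) (y ∧ z)) (x∧y≤y x q)) ⟩
      y ∨ (y ∧ z ∨ d) ∨ q    ≤⟨ ∨-least (x≤x∨y y _)
                                  (∨-least (∨-least (x∧y≤x y z ⨾ x≤x∨y y _) (x≤x∨y d q ⨾ y≤x∨y y _))
                                           (y≤x∨y d q ⨾ y≤x∨y y _)) ⟩
      y ∨ (d ∨ q)            ∎

  ≪-≥⇒≡𝟘 : ∀ {a b} → b ≪ a → a ≤ b → a ≡ 𝟘
  ≪-≥⇒≡𝟘 {a} (a-b≡a , _) a≤b = ≤-antisym (≤-reflexive (sym a-b≡a) ⨾ x≤y⇒x-y≤𝟘 a≤b) (𝟘-least a)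

  ≤-≪-trans : ∀ {a b y} → y ≤ b → b ≪ a → y ≪ a
  ≤-≪-trans {a} {b} {y} y≤b (a-b≡a , b≤a) =
    ≤-antisym (x-y≤x a y) (≤-reflexive (sym a-b≡a) ⨾ -‿antitoneʳ a y≤b) , y≤b ⨾ b≤a

infixr 2 _×ᶜ_

_×ᶜ_ : ∀ {ℓ ℓ'} → CoHeyting ℓ → CoHeyting ℓ' → CoHeyting (ℓ ⊔ ℓ')
L ×ᶜ M = record
  { Carrier     = L.Carrier × M.Carrier
  ; 𝟘           = L.𝟘 , M.𝟘
  ; 𝟙           = L.𝟙 , M.𝟙
  ; _∨_         = zip′ L._∨_ M._∨_
  ; _∧_         = zip′ L._∧_ M._∧_
  ; _-_         = zip′ L._-_ M._-_
  ; ∨-assoc     = λ _ _ _ → cong₂ _,_ (L.∨-assoc _ _ _) (M.∨-assoc _ _ _)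
  ; ∧-assoc     = λ _ _ _ → cong₂ _,_ (L.∧-assoc _ _ _) (M.∧-assoc _ _ _)
  ; ∨-comm      = λ _ _ → cong₂ _,_ (L.∨-comm _ _) (M.∨-comm _ _)
  ; ∧-comm      = λ _ _ → cong₂ _,_ (L.∧-comm _ _) (M.∧-comm _ _)
  ; ∨-absorb    = λ _ _ → cong₂ _,_ (L.∨-absorb _ _) (M.∨-absorb _ _)
  ; ∧-absorb    = λ _ _ → cong₂ _,_ (L.∧-absorb _ _) (M.∧-absorb _ _)
  ; ∧-distrib-∨ = λ _ _ _ → cong₂ _,_ (L.∧-distrib-∨ _ _ _) (M.∧-distrib-∨ _ _ _)
  ; 𝟘-least     = λ _ → cong₂ _,_ (L.𝟘-least _) (M.𝟘-least _)
  ; 𝟙-great     = λ _ → cong₂ _,_ (L.𝟙-great _) (M.𝟙-great _)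
  ; -‿covers    = λ _ _ → cong₂ _,_ (L.-‿covers _ _) (M.-‿covers _ _)
  ; -‿least     = λ _ _ _ p≤q∨r → cong₂ _,_ (L.-‿least _ _ _ (cong proj₁ p≤q∨r))
                                             (M.-‿least _ _ _ (cong proj₂ p≤q∨r))
  }
  where
  module L = CoHeyting L
  module M = CoHeyting M

record IsJoinClosure {ℓ} (P : CoHeyting ℓ) (κ : CoHeyting.Carrier P → CoHeyting.Carrier P) : Set ℓ where
  open CoHeyting P
  field
    extensive     : ∀ p → p ≤ κ p
    monotone      : ∀ {p q} → p ≤ q → κ p ≤ κ q
    idempotent    : ∀ p → κ (κ p) ≤ κ p
    ∨-subadditive : ∀ p q → κ (p ∨ q) ≤ κ p ∨ κ q

module _ {ℓ} (P : CoHeyting ℓ) where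
  open CoHeyting P
  open CoHeytingProperties P

  ∨-isJoinClosure : (g : Carrier → Carrier) →
                    (∀ {p q} → p ≤ q → g p ≤ g q) →
                    (∀ p q → g (p ∨ q) ≤ g p ∨ g q) →
                    (∀ p → g (p ∨ g p) ≤ p ∨ g p) →
                    IsJoinClosure P (λ p → p ∨ g p)
  ∨-isJoinClosure g g-mono g-subadditive g-stable = record
    { extensive     = λ p → x≤x∨y p (g p)
    ; monotone      = λ p≤q → ∨-monotonic p≤q (g-mono p≤q)
    ; idempotent    = λ p → ∨-least ≤-refl (g-stable p)
    ; ∨-subadditive = λ p q → ∨-monotonic ≤-refl (g-subadditive p q) ⨾ ∨-interchange p q (g p) (g q)
    }

module FixedPoints {ℓ} (P : CoHeyting ℓ) {κ : CoHeyting.Carrier P → CoHeyting.Carrier P}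
                   (isJoinClosure : IsJoinClosure P κ)
                   (t : CoHeyting.Carrier P) (κt≤t : CoHeyting._≤_ P (κ t) t) where
  open CoHeyting P
  open CoHeytingProperties P
  open IsJoinClosure isJoinClosure

  record Fixed : Set ℓ where
    constructor fixed
    field
      point  : Carrier
      closed : κ point ≤ point
      below  : point ≤ t

  open Fixed public

  point-injective : ∀ {x y : Fixed} → point x ≡ point y → x ≡ y
  point-injective {fixed p c b} {fixed .p c' b'} refl = cong₂ (fixed p) (uip c c') (uip b b')

  private
    closure : ∀ p → p ≤ t → Fixed
    closure p p≤t = fixed (κ p) (idempotent p) (monotone p≤t ⨾ κt≤t)

    closure-≡ : ∀ {p p≤t} z → p ≤ point z → point z ≤ κ p → closure p p≤t ≡ z
    closure-≡ z p≤z z≤κp = point-injective (≤-antisym (monotone p≤z ⨾ closed z) z≤κp)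

  𝟘ᶠ : Fixed
  𝟘ᶠ = closure 𝟘 (𝟘-least t)

  _-ᶠ_ : Fixed → Fixed → Fixed
  x -ᶠ y = closure (point x - point y) (x-y≤x _ _ ⨾ below x)

  𝟘ᶠ-≡ : ∀ z → point z ≤ κ 𝟘 → 𝟘ᶠ ≡ z
  𝟘ᶠ-≡ z = closure-≡ z (𝟘-least (point z))

  -ᶠ-≡ : ∀ x y z → point x - point y ≤ point z → point z ≤ κ (point x - point y) → x -ᶠ y ≡ z
  -ᶠ-≡ x y = closure-≡

  fixedPoints : CoHeyting ℓ
  fixedPoints = record
    { Carrier     = Fixed
    ; 𝟘           = 𝟘ᶠ
    ; 𝟙           = fixed t κt≤t ≤-refl
    ; _∨_         = λ x y → fixed (point x ∨ point y)
                                  (∨-subadditive _ _ ⨾ ∨-monotonic (closed x) (closed y))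
                                  (∨-least (below x) (below y))
    ; _∧_         = λ x y → fixed (point x ∧ point y)
                                  (∧-greatest (monotone (x∧y≤x _ _) ⨾ closed x)
                                              (monotone (x∧y≤y _ _) ⨾ closed y))
                                  (x∧y≤x _ _ ⨾ below x)
    ; _-_         = _-ᶠ_
    ; ∨-assoc     = λ _ _ _ → point-injective (∨-assoc _ _ _)
    ; ∧-assoc     = λ _ _ _ → point-injective (∧-assoc _ _ _)
    ; ∨-comm      = λ _ _ → point-injective (∨-comm _ _)
    ; ∧-comm      = λ _ _ → point-injective (∧-comm _ _)
    ; ∨-absorb    = λ _ _ → point-injective (∨-absorb _ _)
    ; ∧-absorb    = λ _ _ → point-injective (∧-absorb _ _)
    ; ∧-distrib-∨ = λ _ _ _ → point-injective (∧-distrib-∨ _ _ _)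
    ; 𝟘-least     = λ x → point-injective (monotone (𝟘-least (point x)) ⨾ closed x)
    ; 𝟙-great     = λ x → point-injective (below x)
    ; -‿covers    = λ _ _ → point-injective (-‿covers _ _ ⨾ ∨-monotonic ≤-refl (extensive _))
    ; -‿least     = λ _ _ z x≤y∨z →
                      point-injective (monotone (-‿least _ _ _ (cong point x≤y∨z)) ⨾ closed z)
    }

module DensityExtension {ℓ} (L : CoHeyting ℓ) (c : CoHeyting.Carrier L) where
  open CoHeyting L
  open CoHeytingProperties L

  private
    P : CoHeyting ℓ
    P = L ×ᶜ L

    open CoHeyting P using () renaming (_∨_ to _∨ᴾ_; _≤_ to _≤ᴾ_)

    glue : Carrier × Carrier → Carrier × Carrier
    glue (u , v) = (v - c) ∧ c , u ∨ c

    glue-mono : ∀ {p q} → p ≤ᴾ q → glue p ≤ᴾ glue q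
    glue-mono p≤q = cong₂ _,_ (∧-monotonic (-‿monoˡ-≤ c (cong proj₂ p≤q)) ≤-refl)
                              (∨-monotonic (cong proj₁ p≤q) ≤-refl)

    glue-subadditive : ∀ p q → glue (p ∨ᴾ q) ≤ᴾ glue p ∨ᴾ glue q
    glue-subadditive (u , v) (u' , v') =
      cong₂ _,_ (-‿∧-subadditive c c v v') (≤-reflexive (∨-distribʳ-∨ u u' c))

    glue-stable : ∀ p → glue (p ∨ᴾ glue p) ≤ᴾ p ∨ᴾ glue p
    glue-stable (u , v) =
      cong₂ _,_ (-‿∧-subadditive c c v (u ∨ c)
                 ⨾ ∨-least (y≤x∨y u _) (x∧y≤x _ c ⨾ [x∨y]-y≤x u c ⨾ x≤x∨y u _))
                (∨-least (∨-least (x≤x∨y u c) (x∧y≤y _ c ⨾ y≤x∨y u c)) (y≤x∨y u c) ⨾ y≤x∨y v _)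

  open FixedPoints P (∨-isJoinClosure P glue glue-mono glue-subadditive glue-stable)
                     (𝟙 , 𝟙) (cong₂ _,_ (𝟙-great _) (𝟙-great _))

  algebra : CoHeyting ℓ
  algebra = fixedPoints

  open CoHeyting algebra using () renaming (𝟘 to 𝟘ᴳ; _-_ to _-ᴳ_; _≤_ to _≤ᴳ_; _≪_ to _≪ᴳ_)

  private
    inject : Carrier → Fixed
    inject x = fixed (x , x ∨ c)
                     (cong₂ _,_ (∨-least ≤-refl (x∧y≤x _ c ⨾ [x∨y]-y≤x x c)) (∨-least ≤-refl ≤-refl))
                     (cong₂ _,_ (𝟙-great _) (𝟙-great _))

  ι : Embedding L algebra
  ι = record
    { f     = inject
    ; f-inj = cong (proj₁ ∘ point)
    ; f-𝟘   = sym (𝟘ᶠ-≡ (inject 𝟘) (cong₂ _,_ (x≤x∨y _ _) (y≤x∨y _ _)))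
    ; f-𝟙   = point-injective (cong₂ _,_ refl (≤-antisym (𝟙-great _) (x≤x∨y 𝟙 c)))
    ; f-∨   = λ x y → point-injective (cong₂ _,_ refl (∨-distribʳ-∨ x y c))
    ; f-∧   = λ x y → point-injective (cong₂ _,_ refl (∨-distribʳ-∧ c x y))
    ; f-−   = λ x y → sym (-ᶠ-≡ (inject x) (inject y) (inject (x - y))
                              (cong₂ _,_ ≤-refl ([x∨z]-[y∨z]≤x-y x y c ⨾ x≤x∨y (x - y) c))
                              (cong₂ _,_ (x≤x∨y _ _) (y≤x∨y _ _)))
    }

  open Embedding ι using (f)

  dense : ∀ {a} → c ≪ a → a ≢ 𝟘 → Σ Fixed λ b → (b ≢ 𝟘ᴳ) × (f c ≪ᴳ b) × (b ≪ᴳ f a)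
  dense {a} c≪a@(a-c≡a , c≤a) a≢𝟘 = b , b≢𝟘 , (b-c≡b , c≤b) , (a-b≡a , b≤a)
    where
    b : Fixed
    b = fixed (c , a) (cong₂ _,_ (∨-least ≤-refl (x∧y≤y _ c)) (∨-least ≤-refl (∨-least c≤a c≤a)))
                      (cong₂ _,_ (𝟙-great c) (𝟙-great a))

    b≢𝟘 : b ≢ 𝟘ᴳ
    b≢𝟘 b≡𝟘 = a≢𝟘 (≪-≥⇒≡𝟘 c≪a (≤-reflexive (cong (proj₂ ∘ point) b≡𝟘)
                                ⨾ ∨-least (𝟘-least c) (∨-least (𝟘-least c) ≤-refl)))

    a≤[a-[c∨c]]-c : a ≤ (a - (c ∨ c)) - c
    a≤[a-[c∨c]]-c = ≤-reflexive (sym (begin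
      (a - (c ∨ c)) - c  ≡⟨ cong (_- c) (proj₁ (≤-≪-trans (∨-least ≤-refl ≤-refl) c≪a)) ⟩
      a - c              ≡⟨ a-c≡a ⟩
      a                  ∎))
      where open ≡-Reasoning

    b-c≡b : b -ᴳ f c ≡ b
    b-c≡b = -ᶠ-≡ b (f c) b
      (cong₂ _,_ (x-y≤x c c) (x-y≤x a _))
      (cong₂ _,_ (∧-greatest (c≤a ⨾ a≤[a-[c∨c]]-c) ≤-refl ⨾ y≤x∨y _ _)
                 (a≤[a-[c∨c]]-c ⨾ x-y≤x _ c ⨾ x≤x∨y _ _))

    c≤b : f c ≤ᴳ b
    c≤b = point-injective (cong₂ _,_ ≤-refl (∨-least c≤a c≤a))

    a-b≡a : f a -ᴳ b ≡ f a
    a-b≡a = -ᶠ-≡ (f a) b (f a)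
      (cong₂ _,_ (x-y≤x a c) (x-y≤x _ _))
      (cong₂ _,_ (≤-reflexive (sym a-c≡a) ⨾ x≤x∨y _ _)
                 (∨-monotonic (≤-reflexive (sym a-c≡a)) ≤-refl ⨾ y≤x∨y _ _))

    b≤a : b ≤ᴳ f a
    b≤a = point-injective (cong₂ _,_ c≤a (x≤x∨y a c))

module SplittingExtension {ℓ} (L : CoHeyting ℓ) (b₁ b₂ : CoHeyting.Carrier L) where
  open CoHeyting L
  open CoHeytingProperties L

  private
    β : Carrier
    β = b₁ ∧ b₂

    P : CoHeyting ℓ
    P = L ×ᶜ L ×ᶜ L

    open CoHeyting P using () renaming (_∨_ to _∨ᴾ_; _≤_ to _≤ᴾ_)

    glue : Carrier × Carrier × Carrier → Carrier × Carrier × Carrier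
    glue (w , v₁ , v₂) = (v₁ - b₁) ∧ β ∨ (v₂ - b₂) ∧ β , b₁ , b₂

    glue-mono : ∀ {p q} → p ≤ᴾ q → glue p ≤ᴾ glue q
    glue-mono p≤q =
      cong₂ _,_ (∨-monotonic (∧-monotonic (-‿monoˡ-≤ b₁ (cong (proj₁ ∘ proj₂) p≤q)) ≤-refl)
                             (∧-monotonic (-‿monoˡ-≤ b₂ (cong (proj₂ ∘ proj₂) p≤q)) ≤-refl))
                (cong₂ _,_ ≤-refl ≤-refl)

    glue-subadditive : ∀ p q → glue (p ∨ᴾ q) ≤ᴾ glue p ∨ᴾ glue q
    glue-subadditive (_ , v₁ , v₂) (_ , v₁' , v₂') =
      cong₂ _,_ (∨-monotonic (-‿∧-subadditive b₁ β v₁ v₁') (-‿∧-subadditive b₂ β v₂ v₂')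
                 ⨾ ∨-interchange _ _ _ _)
                (cong₂ _,_ (x≤x∨y b₁ b₁) (x≤x∨y b₂ b₂))

    glue-stable : ∀ p → glue (p ∨ᴾ glue p) ≤ᴾ p ∨ᴾ glue p
    glue-stable (w , v₁ , v₂) =
      cong₂ _,_ (∨-monotonic (∧-monotonic ([x∨y]-y≤x-y v₁ b₁) ≤-refl)
                             (∧-monotonic ([x∨y]-y≤x-y v₂ b₂) ≤-refl)
                 ⨾ y≤x∨y w _)
                (cong₂ _,_ (y≤x∨y v₁ b₁) (y≤x∨y v₂ b₂))

  open FixedPoints P (∨-isJoinClosure P glue glue-mono glue-subadditive glue-stable) (β , 𝟙 , 𝟙)
                     (cong₂ _,_ (∨-least ≤-refl (∨-least (x∧y≤y _ β) (x∧y≤y _ β)))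
                                (cong₂ _,_ (𝟙-great _) (𝟙-great _)))

  algebra : CoHeyting ℓ
  algebra = fixedPoints

  open CoHeyting algebra using () renaming (𝟘 to 𝟘ᴳ; _-_ to _-ᴳ_; _∧_ to _∧ᴳ_; _≤_ to _≤ᴳ_)

  private
    inject : Carrier → Fixed
    inject x = fixed (x ∧ β , x ∨ b₁ , x ∨ b₂)
      (cong₂ _,_ (∨-least ≤-refl (∨-least (∧-monotonic ([x∨y]-y≤x x b₁) ≤-refl)
                                          (∧-monotonic ([x∨y]-y≤x x b₂) ≤-refl)))
                 (cong₂ _,_ (∨-least ≤-refl (y≤x∨y x b₁)) (∨-least ≤-refl (y≤x∨y x b₂))))
      (cong₂ _,_ (x∧y≤y x β) (cong₂ _,_ (𝟙-great _) (𝟙-great _)))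

    inject-injective : ∀ {x y} → inject x ≡ inject y → x ≡ y
    inject-injective {x} {y} eq = ∧-∨-cancelʳ (cong (proj₁ ∘ point) eq) (begin
      x ∨ β                ≡⟨ ∨-distribˡ-∧ x b₁ b₂ ⟩
      (x ∨ b₁) ∧ (x ∨ b₂)  ≡⟨ cong₂ _∧_ (cong (proj₁ ∘ proj₂ ∘ point) eq)
                                       (cong (proj₂ ∘ proj₂ ∘ point) eq) ⟩
      (y ∨ b₁) ∧ (y ∨ b₂)  ≡⟨ sym (∨-distribˡ-∧ y b₁ b₂) ⟩
      y ∨ β                ∎)
      where open ≡-Reasoning

    inject-− : ∀ x y → inject (x - y) ≡ inject x -ᴳ inject y
    inject-− x y = sym (-ᶠ-≡ (inject x) (inject y) (inject (x - y))
      (cong₂ _,_ ([x∧z]-[y∧z]≤[x-y]∧z x y β) (cong₂ _,_ (upper≤ b₁) (upper≤ b₂)))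
      (cong₂ _,_ ([x-y]∧z≤[x∧z]-[y∧z]∨q∧z x-y≤β∨e₁∨e₂
                  ⨾ ∨-monotonic ≤-refl (≤-reflexive (∧-distribʳ-∨ β (d b₁ - b₁) (d b₂ - b₂))))
                 (cong₂ _,_ (≤upper b₁) (≤upper b₂))))
      where
      d : Carrier → Carrier
      d b = (x ∨ b) - (y ∨ b)

      upper≤ : ∀ b → d b ≤ (x - y) ∨ b
      upper≤ b = [x∨z]-[y∨z]≤x-y x y b ⨾ x≤x∨y (x - y) b

      ≤upper : ∀ b → (x - y) ∨ b ≤ d b ∨ b
      ≤upper b = ∨-least (x-y≤z∨[[x∨z]-[y∨z]-z] x y b
                          ⨾ ∨-least (y≤x∨y (d b) b) (x-y≤x (d b) b ⨾ x≤x∨y (d b) b))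
                         (y≤x∨y (d b) b)

      x-y≤β∨e₁∨e₂ : x - y ≤ β ∨ ((d b₁ - b₁) ∨ (d b₂ - b₂))
      x-y≤β∨e₁∨e₂ = ∧-greatest (x-y≤z∨[[x∨z]-[y∨z]-z] x y b₁) (x-y≤z∨[[x∨z]-[y∨z]-z] x y b₂)
                    ⨾ [x∨y]∧[z∨w]≤x∧z∨[y∨w] b₁ (d b₁ - b₁) b₂ (d b₂ - b₂)

  ι : Embedding L algebra
  ι = record
    { f     = inject
    ; f-inj = inject-injective
    ; f-𝟘   = sym (𝟘ᶠ-≡ (inject 𝟘) (cong₂ _,_ (x∧y≤x 𝟘 β ⨾ 𝟘-least _) (cong₂ _,_ ≤-refl ≤-refl)))
    ; f-𝟙   = point-injective (cong₂ _,_ (y≤x⇒x∧y≈y (𝟙-great β))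
                                (cong₂ _,_ (≤-antisym (𝟙-great _) (x≤x∨y 𝟙 b₁))
                                           (≤-antisym (𝟙-great _) (x≤x∨y 𝟙 b₂))))
    ; f-∨   = λ x y → point-injective (cong₂ _,_ (∧-distribʳ-∨ β x y)
                                        (cong₂ _,_ (∨-distribʳ-∨ x y b₁) (∨-distribʳ-∨ x y b₂)))
    ; f-∧   = λ x y → point-injective (cong₂ _,_ (∧-distribʳ-∧ x y β)
                                        (cong₂ _,_ (∨-distribʳ-∧ b₁ x y) (∨-distribʳ-∧ b₂ x y)))
    ; f-−   = inject-−
    }

  open Embedding ι using (f; f-∧)

  splits : ∀ {a} → (b₁ ∨ b₂) ≪ a → a ≢ 𝟘 →
           Σ Fixed λ a₁ → Σ Fixed λ a₂ →
             (a₁ ≢ 𝟘ᴳ) × (a₂ ≢ 𝟘ᴳ) ×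
             (f a -ᴳ a₂ ≡ a₁) × (f b₁ ≤ᴳ a₁) ×
             (f a -ᴳ a₁ ≡ a₂) × (f b₂ ≤ᴳ a₂) ×
             (a₁ ∧ᴳ a₂ ≡ f b₁ ∧ᴳ f b₂)
  splits {a} b≪a@(_ , b₁∨b₂≤a) a≢𝟘 =
    a₁ , a₂ , a₁≢𝟘 , a₂≢𝟘 , a-a₂≡a₁ , b₁≤a₁ , a-a₁≡a₂ , b₂≤a₂ , a₁∧a₂≡b₁∧b₂
    where
    b₁≤a : b₁ ≤ a
    b₁≤a = x≤x∨y b₁ b₂ ⨾ b₁∨b₂≤a

    b₂≤a : b₂ ≤ a
    b₂≤a = y≤x∨y b₁ b₂ ⨾ b₁∨b₂≤a

    a≰b₁∨b₂ : ¬ a ≤ b₁ ∨ b₂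
    a≰b₁∨b₂ = a≢𝟘 ∘ ≪-≥⇒≡𝟘 b≪a

    a≤[a∨b]-b : ∀ {b} → b ≤ b₁ ∨ b₂ → a ≤ (a ∨ b) - b
    a≤[a∨b]-b {b} b≤ = ≤-reflexive (sym (proj₁ (≤-≪-trans b≤ b≪a))) ⨾ -‿monoˡ-≤ b (x≤x∨y a b)

    β≤[[a∨b]-b]-b : ∀ {b} → b ≤ b₁ ∨ b₂ → β ≤ ((a ∨ b) - b) - b
    β≤[[a∨b]-b]-b {b} b≤ = x∧y≤x b₁ b₂ ⨾ b₁≤a ⨾ ≤-reflexive (sym (proj₁ (≤-≪-trans b≤ b≪a)))
                           ⨾ -‿monoˡ-≤ b (a≤[a∨b]-b b≤)

    fixedAtβ : ∀ v₁ v₂ → b₁ ≤ v₁ → b₂ ≤ v₂ → Fixed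
    fixedAtβ v₁ v₂ b₁≤v₁ b₂≤v₂ = fixed (β , v₁ , v₂)
      (cong₂ _,_ (∨-least ≤-refl (∨-least (x∧y≤y _ β) (x∧y≤y _ β)))
                 (cong₂ _,_ (∨-least ≤-refl b₁≤v₁) (∨-least ≤-refl b₂≤v₂)))
      (cong₂ _,_ ≤-refl (cong₂ _,_ (𝟙-great _) (𝟙-great _)))

    a₁ a₂ : Fixed
    a₁ = fixedAtβ b₁ a ≤-refl b₂≤a
    a₂ = fixedAtβ a b₂ b₁≤a ≤-refl

    a₁≢𝟘 : a₁ ≢ 𝟘ᴳ
    a₁≢𝟘 eq = a≰b₁∨b₂ (≤-reflexive (cong (proj₂ ∘ proj₂ ∘ point) eq)
                       ⨾ ∨-least (𝟘-least _) (y≤x∨y b₁ b₂))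

    a₂≢𝟘 : a₂ ≢ 𝟘ᴳ
    a₂≢𝟘 eq = a≰b₁∨b₂ (≤-reflexive (cong (proj₁ ∘ proj₂ ∘ point) eq)
                       ⨾ ∨-least (𝟘-least _) (x≤x∨y b₁ b₂))

    a-a₂≡a₁ : f a -ᴳ a₂ ≡ a₁
    a-a₂≡a₁ = -ᶠ-≡ (f a) a₂ a₁
      (cong₂ _,_ (x-y≤x _ β ⨾ x∧y≤y a β)
                 (cong₂ _,_ (-‿least (a ∨ b₁) a b₁ ≤-refl) ([x∨y]-y≤x a b₂)))
      (cong₂ _,_ (∧-greatest (β≤[[a∨b]-b]-b (y≤x∨y b₁ b₂)) ≤-refl ⨾ y≤x∨y _ _ ⨾ y≤x∨y _ _)
                 (cong₂ _,_ (y≤x∨y _ b₁) (a≤[a∨b]-b (y≤x∨y b₁ b₂) ⨾ x≤x∨y _ b₂)))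

    a-a₁≡a₂ : f a -ᴳ a₁ ≡ a₂
    a-a₁≡a₂ = -ᶠ-≡ (f a) a₁ a₂
      (cong₂ _,_ (x-y≤x _ β ⨾ x∧y≤y a β)
                 (cong₂ _,_ ([x∨y]-y≤x a b₁) (-‿least (a ∨ b₂) a b₂ ≤-refl)))
      (cong₂ _,_ (∧-greatest (β≤[[a∨b]-b]-b (x≤x∨y b₁ b₂)) ≤-refl ⨾ x≤x∨y _ _ ⨾ y≤x∨y _ _)
                 (cong₂ _,_ (a≤[a∨b]-b (x≤x∨y b₁ b₂) ⨾ x≤x∨y _ b₁) (y≤x∨y _ b₂)))

    b₁≤a₁ : f b₁ ≤ᴳ a₁
    b₁≤a₁ = point-injective (cong₂ _,_ (x∧y≤y _ _) (cong₂ _,_ (∨-least ≤-refl ≤-refl) b₁∨b₂≤a))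

    b₂≤a₂ : f b₂ ≤ᴳ a₂
    b₂≤a₂ = point-injective
      (cong₂ _,_ (x∧y≤y _ _) (cong₂ _,_ (∨-least b₂≤a b₁≤a) (∨-least ≤-refl ≤-refl)))

    a₁∧a₂≡b₁∧b₂ : a₁ ∧ᴳ a₂ ≡ f b₁ ∧ᴳ f b₂
    a₁∧a₂≡b₁∧b₂ = trans (point-injective (cong₂ _,_ refl (cong₂ _,_
                          (trans b₁≤a (sym (x≤y⇒x∨y≈y (x∧y≤x b₁ b₂))))
                          (trans (y≤x⇒x∧y≈y b₂≤a) (sym (x≤y⇒x∨y≈y (x∧y≤y b₁ b₂)))))))
                        (f-∧ b₁ b₂)

-- Chosen so that ⟦ s `≪ t ⟧q unfolds definitionally to ⟦ s ⟧t ≪ ⟦ t ⟧t (likewise `≤, `≢);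
-- D1 and S1 are then literally the satisfaction in L of the two formulas below.
module _ {p} {P : Set p} {n : ℕ} where
  infix 4 _`≢_ _`≤_ _`≪_

  _`≢_ _`≤_ _`≪_ : Term P n → Term P n → QF P n
  s `≢ t = `¬ (s `≡ t)
  s `≤ t = (s `∧ t) `≡ s
  s `≪ t = ((t `- s) `≡ t) `× (s `≤ t)

densityFormula : ∀ {p} {P : Set p} → P → P → ExFormula P
densityFormula a c = ∃[ 1 ] ((b `≢ `𝟘) `× ((par c `≪ b) `× (b `≪ par a)))
  where b = var zero

splittingFormula : ∀ {p} {P : Set p} → P → P → P → ExFormula P
splittingFormula a b₁ b₂ =
  ∃[ 2 ] ((a₁ `≢ `𝟘) `× ((a₂ `≢ `𝟘) `×
          (((par a `- a₂) `≡ a₁) `× ((par b₁ `≤ a₁) `×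
          (((par a `- a₁) `≡ a₂) `× ((par b₂ `≤ a₂) `×
          ((a₁ `∧ a₂) `≡ (par b₁ `∧ par b₂))))))))
  where
  a₁ = var zero
  a₂ = var (suc zero)

theorem4p3 : ∀ {ℓ} (L : CoHeyting ℓ) → IsExistentiallyClosed L → D1 L × S1 L
theorem4p3 L ec = density , splitting
  where
  density : D1 L
  density a c c≪a a≢𝟘 =
    let b , holds = dense c≪a a≢𝟘
        ρ , holds′ = ec algebra ι (densityFormula a c) ((λ _ → b) , holds)
    in ρ zero , holds′
    where open DensityExtension L c

  splitting : S1 L
  splitting a b₁ b₂ b≪a a≢𝟘 =
    let a₁ , a₂ , holds = splits b≪a a≢𝟘
        ρ , holds′ = ec algebra ι (splittingFormula a b₁ b₂) ((λ { zero → a₁ ; (suc _) → a₂ }) , holds)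
    in ρ zero , ρ (suc zero) , holds′
    where open SplittingExtension L b₁ b₂
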